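{- Let $G$ be a $3$-edge-connected multigraph with DFS tree $\mathcal{T}$. Let $e,f$ be tree edges with $e<_{\mathcal{T}}f$ and $g$ a back edge connecting $\mathcal{T}_f$ with $\mathcal{T}_e\setminus\mathcal{T}_f$ such that $\{e,f,g\}$ is a $3$-edge-cut of $G$. Then $e$ is the deepest tree edge $e'$ with $e'<_{\mathcal{T}}f$ satisfying $\mathrm{DeepestDnCut}(e')\ge_{\mathcal{T}}f$.
   Context: $G$ is $3$-edge-connected if connected and remains connected after removing any at most $2$ edges; a $3$-edge-cut is a set of $3$ edges whose removal disconnects $G$. A DFS tree $\mathcal{T}$ rooted at $r$ consists of the edges traversed by a depth-first search; other edges are back edges joining ancestor–descendant pairs. Tree edges are directed away from $r$, back edges toward $r$; tail = origin, head = destination. $x\le_{\mathcal{T}}y$ if the tree path from $r$ to $y$ contains $x$. For a tree edge $e$, $\mathcal{T}_e$ is the subtree rooted at the head of $e$; a back edge $pq$ leaps over $e$ if $p\in\mathcal{T}_e$, $q\notin\mathcal{T}_e$. $\mathrm{DeepestDnCut}(e)$ is the deepest tree edge $f\ge_{\mathcal{T}}e$ such that every back edge leaping over $e$ has its tail in $\mathcal{T}_f$. -}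

module Defs where

open import Data.Nat using (ℕ; _<_)
open import Data.Fin using (Fin)
open import Data.Product using (Σ; _×_; ∃)
open import Data.Sum using (_⊎_)
open import Relation.Nullary using (¬_)
open import Data.Empty using (⊥)
open import Relation.Binary.PropositionalEquality using (_≡_; _≢_)

-- A finite multigraph: vertices Fin n, edges Fin m, each edge has two
-- (unordered) endpoints src/dst. Parallel edges (and loops) allowed.
record Graph (n m : ℕ) : Set where
  field
    src dst : Fin m → Fin n
open Graph public

module _ {n m : ℕ} (G : Graph n m) where

  Ends : Fin m → Fin n → Fin n → Set
  Ends x a b = (src G x ≡ a × dst G x ≡ b) ⊎ (src G x ≡ b × dst G x ≡ a)

  data Reach (removed : Fin m → Set) : Fin n → Fin n → Set where
    stay : ∀ {u} → Reach removed u u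
    step : ∀ {u w v} (x : Fin m) → ¬ removed x → Ends x u w →
           Reach removed w v → Reach removed u v

  ConnectedWithout : (Fin m → Set) → Set
  ConnectedWithout removed = ∀ u v → Reach removed u v

  ThreeEdgeConnected : Set
  ThreeEdgeConnected =
    ConnectedWithout (λ _ → ⊥) ×
    (∀ (e₁ e₂ : Fin m) → ConnectedWithout (λ x → x ≡ e₁ ⊎ x ≡ e₂))

  IsThreeEdgeCut : Fin m → Fin m → Fin m → Set
  IsThreeEdgeCut a b c =
    a ≢ b × a ≢ c × b ≢ c ×
    ¬ ConnectedWithout (λ x → x ≡ a ⊎ x ≡ b ⊎ x ≡ c)

  -- A rooted spanning tree given by a parent map; pe v is the tree edge
  -- joining a non-root vertex v to its parent. Tree edges are exactly the
  -- pe v for v ≢ root.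
  record SpanningTree : Set where
    field
      root  : Fin n
      par   : Fin n → Fin n
      depth : Fin n → ℕ
      pe    : Fin n → Fin m
      depth-dec : ∀ v → v ≢ root → depth (par v) < depth v
      pe-ends   : ∀ v → v ≢ root → Ends (pe v) v (par v)

  module Tree (T : SpanningTree) where
    open SpanningTree T

    -- Anc x y  :  x ≤_T y  (x lies on the tree path from root to y)
    data Anc (x : Fin n) : Fin n → Set where
      here : Anc x x
      up   : ∀ {y} → y ≢ root → Anc x (par y) → Anc x y

    -- tree edge e has head (child endpoint) v
    HeadOf : Fin m → Fin n → Set
    HeadOf e v = v ≢ root × pe v ≡ e

    IsTreeEdge : Fin m → Set
    IsTreeEdge e = ∃ (HeadOf e)

    -- x ∈ T_e : the subtree rooted at the head of e
    InSub : Fin m → Fin n → Set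
    InSub e x = Σ (Fin n) (λ v → HeadOf e v × Anc v x)

    _≤T_ : Fin m → Fin m → Set
    e ≤T f = Σ (Fin n) (λ v → Σ (Fin n) (λ w → HeadOf e v × HeadOf f w × Anc v w))

    _<T_ : Fin m → Fin m → Set
    e <T f = e ≤T f × e ≢ f

    -- back edge b with tail p and head q (directed toward the root)
    BackEdge : Fin m → Fin n → Fin n → Set
    BackEdge b p q = ¬ IsTreeEdge b × Ends b p q × Anc q p

    IsBackEdge : Fin m → Set
    IsBackEdge b = ¬ IsTreeEdge b

    TailsIn : Fin m → Fin m → Set
    TailsIn e d = ∀ b p q → BackEdge b p q → InSub e p → ¬ InSub e q → InSub d p

    IsDeepestDnCut : Fin m → Fin m → Set
    IsDeepestDnCut e d =
      IsTreeEdge d × e ≤T d × TailsIn e d ×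
      (∀ d' → IsTreeEdge d' → e ≤T d' → TailsIn e d' → d' ≤T d)

    DnCutGe : Fin m → Fin m → Set
    DnCutGe e f = Σ (Fin m) (λ d → IsDeepestDnCut e d × f ≤T d)

  record DFSTree : Set where
    field
      tree : SpanningTree
    open Tree tree
    field
      back-anc : ∀ x → ¬ IsTreeEdge x → Anc (src G x) (dst G x) ⊎ Anc (dst G x) (src G x)

-- Split the vertices into A = T_f, B = T_e ∖ T_f and C = the rest. Every vertex
-- climbs the tree, avoiding e, f and g, to the top of its part (vf, ve or the
-- root). Since {e,f,g} is a cut while {f,g} is not, B is cut off from the root.
-- Hence every back edge leaping over e has its tail in A, so DeepestDnCut(e) ≥ f;
-- as {e,g} is not a cut such an edge exists, so A reaches the root and g is the
-- only back edge between A and B. If some e' strictly between e and f had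
-- DeepestDnCut(e') ≥ f, the edge that the 2-edge-cut {e,e'} or {e',f} must leave
-- would be a second back edge between A and B.
module Submission where

open import Defs
open import Data.Nat using (ℕ; _≤_; _<_)
open import Data.Nat.Properties using (≤-refl; <⇒≤; <⇒≱; <-asym; ≤-<-trans)
open import Data.Nat.Induction using (<-wellFounded)
open import Induction.WellFounded using (Acc; acc)
open import Data.Fin using (Fin; _≟_)
open import Data.Fin.Properties using (any?; all?)
open import Data.Product using (_×_; Σ; _,_; proj₁; proj₂)
open import Data.Sum using (_⊎_; inj₁; inj₂)
open import Data.Empty using (⊥; ⊥-elim)
open import Function using (_∘_)
open import Relation.Nullary using (¬_; Dec; yes; no)
open import Relation.Nullary.Decidable using (_×-dec_; _⊎-dec_; _→-dec_; ¬?)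
open import Relation.Unary using (Decidable)
open import Relation.Binary.PropositionalEquality using (_≡_; _≢_; refl; sym; cong; subst)

module _ {n m : ℕ} (G : Graph n m) where

  ends-sym : ∀ {x a b} → Ends G x a b → Ends G x b a
  ends-sym (inj₁ p) = inj₂ p
  ends-sym (inj₂ p) = inj₁ p

  ends-match : ∀ {x a b c d} → Ends G x a b → Ends G x c d →
               (a ≡ c × b ≡ d) ⊎ (a ≡ d × b ≡ c)
  ends-match (inj₁ (refl , refl)) (inj₁ (refl , refl)) = inj₁ (refl , refl)
  ends-match (inj₁ (refl , refl)) (inj₂ (refl , refl)) = inj₂ (refl , refl)
  ends-match (inj₂ (refl , refl)) (inj₁ (refl , refl)) = inj₂ (refl , refl)
  ends-match (inj₂ (refl , refl)) (inj₂ (refl , refl)) = inj₁ (refl , refl)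

  ends? : ∀ x a b → Dec (Ends G x a b)
  ends? x a b = ((src G x ≟ a) ×-dec (dst G x ≟ b)) ⊎-dec ((src G x ≟ b) ×-dec (dst G x ≟ a))

  record Exit (R : Fin m → Set) (X : Fin n → Set) : Set where
    constructor exit
    field
      edge         : Fin m
      inner outer  : Fin n
      kept         : ¬ R edge
      ends         : Ends G edge inner outer
      inside       : X inner
      outside      : ¬ X outer

  reach-exit : ∀ {R} (X : Fin n → Set) → Decidable X → ∀ {u v} →
               X u → ¬ X v → Reach G R u v → Exit R X
  reach-exit X X? u∈X v∉X stay = ⊥-elim (v∉X u∈X)
  reach-exit X X? {u} u∈X v∉X (step {w = w} x kept en r) with X? w
  ... | yes w∈X = reach-exit X X? w∈X v∉X r
  ... | no w∉X = exit x u w kept en u∈X w∉X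

module _ {n m : ℕ} {G : Graph n m} {R : Fin m → Set} where

  reach-trans : ∀ {u w v} → Reach G R u w → Reach G R w v → Reach G R u v
  reach-trans stay r = r
  reach-trans (step x kept en r) r′ = step x kept en (reach-trans r r′)

  reach-sym : ∀ {u v} → Reach G R u v → Reach G R v u
  reach-sym stay = stay
  reach-sym (step x kept en r) = reach-trans (reach-sym r) (step x kept (ends-sym G en) stay)

module SpanningTreeProperties {n m : ℕ} {G : Graph n m} (T : SpanningTree G) where
  open SpanningTree T
  open Tree G T

  anc-depth : ∀ {x y} → Anc x y → depth x ≤ depth y
  anc-depth here = ≤-refl
  anc-depth (up {y} y≢r a) = <⇒≤ (≤-<-trans (anc-depth a) (depth-dec y y≢r))

  anc-antisym : ∀ {x y} → Anc x y → Anc y x → x ≡ y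
  anc-antisym here _ = refl
  anc-antisym (up {y} y≢r a) b = ⊥-elim (<⇒≱ (≤-<-trans (anc-depth a) (depth-dec y y≢r)) (anc-depth b))

  anc-trans : ∀ {x y z} → Anc x y → Anc y z → Anc x z
  anc-trans a here = a
  anc-trans a (up z≢r b) = up z≢r (anc-trans a b)

  anc-chain : ∀ {x y z} → Anc x z → Anc y z → Anc x y ⊎ Anc y x
  anc-chain here b = inj₂ b
  anc-chain (up z≢r a) here = inj₁ (up z≢r a)
  anc-chain (up _ a) (up _ b) = anc-chain a b

  anc-inv : ∀ {x u} → Anc x u → x ≢ u → u ≢ root × Anc x (par u)
  anc-inv here x≢u = ⊥-elim (x≢u refl)
  anc-inv (up u≢r a) _ = u≢r , a

  ¬anc-root : ∀ {x} → x ≢ root → ¬ Anc x root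
  ¬anc-root x≢r here = x≢r refl
  ¬anc-root _ (up r≢r _) = r≢r refl

  ¬anc-par : ∀ {u} → u ≢ root → ¬ Anc u (par u)
  ¬anc-par {u} u≢r a = <⇒≱ (depth-dec u u≢r) (anc-depth a)

  root-anc : ∀ u → Anc root u
  root-anc u = go u (<-wellFounded (depth u))
    where
    go : ∀ u → Acc _<_ (depth u) → Anc root u
    go u (acc rs) with u ≟ root
    ... | yes refl = here
    ... | no u≢r = up u≢r (go (par u) (rs (depth-dec u u≢r)))

  anc? : ∀ x y → Dec (Anc x y)
  anc? x y = go x (root-anc y)
    where
    go : ∀ x {y} → Anc root y → Dec (Anc x y)
    go x here with x ≟ root
    ... | yes refl = yes here
    ... | no x≢r = no (¬anc-root x≢r)
    go x {y} (up y≢r r) with x ≟ y | go x r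
    ... | yes refl | _ = yes here
    ... | no _ | yes a = yes (up y≢r a)
    ... | no x≢y | no ¬a = no (¬a ∘ proj₂ ∘ λ a → anc-inv a x≢y)

  Between : Fin n → Fin n → Fin n → Set
  Between u v x = Anc u x × ¬ Anc v x

  between? : ∀ u v → Decidable (Between u v)
  between? u v x = anc? u x ×-dec ¬? (anc? v x)

  climb : ∀ {R w u} → Anc w u → (∀ {y} → y ≢ w → Anc w y → Anc y u → ¬ R (pe y)) →
          Reach G R u w
  climb here _ = stay
  climb (up {u} u≢r a) keep =
    step (pe u) (keep u≢w (up u≢r a) here) (pe-ends u u≢r)
         (climb a (λ y≢w w≤y y≤pu → keep y≢w w≤y (up u≢r y≤pu)))
    where
    u≢w : u ≢ _
    u≢w refl = ¬anc-par u≢r a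

  head-unique : ∀ {e v w} → HeadOf e v → HeadOf e w → v ≡ w
  head-unique {v = v} {w} (v≢r , refl) (w≢r , eq)
    with ends-match G (pe-ends v v≢r) (subst (λ x → Ends G x w (par w)) eq (pe-ends w w≢r))
  ... | inj₁ (v≡w , _) = v≡w
  ... | inj₂ (v≡pw , pv≡w) =
    ⊥-elim (<-asym (subst (λ z → depth z < depth v) pv≡w (depth-dec v v≢r))
                   (subst (λ z → depth z < depth w) (sym v≡pw) (depth-dec w w≢r)))

  inSub→anc : ∀ {e v x} → HeadOf e v → InSub e x → Anc v x
  inSub→anc {x = x} he (w , hw , a) = subst (λ z → Anc z x) (head-unique hw he) a

  ≤T→anc : ∀ {e f v w} → HeadOf e v → HeadOf f w → e ≤T f → Anc v w
  ≤T→anc he hf (v , w , hv , hw , a) =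
    subst (λ z → Anc z _) (head-unique hv he) (subst (Anc v) (head-unique hw hf) a)

  headOf? : ∀ e v → Dec (HeadOf e v)
  headOf? e v = ¬? (v ≟ root) ×-dec (pe v ≟ e)

  tree? : ∀ e → Dec (IsTreeEdge e)
  tree? e = any? (headOf? e)

  inSub? : ∀ e x → Dec (InSub e x)
  inSub? e x = any? (λ v → headOf? e v ×-dec anc? v x)

  backEdge? : ∀ b p q → Dec (BackEdge b p q)
  backEdge? b p q = ¬? (tree? b) ×-dec ends? G b p q ×-dec anc? q p

  tailsIn? : ∀ e d → Dec (TailsIn e d)
  tailsIn? e d = all? (λ b → all? (λ p → all? (λ q →
    backEdge? b p q →-dec inSub? e p →-dec ¬? (inSub? e q) →-dec inSub? d p)))

  orient : ∀ {e f v w g} → HeadOf e v → HeadOf f w →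
           (InSub f (src G g) × InSub e (dst G g) × ¬ InSub f (dst G g)) ⊎
           (InSub f (dst G g) × InSub e (src G g) × ¬ InSub f (src G g)) →
           Σ (Fin n) λ t → Σ (Fin n) λ h →
             Ends G g t h × Anc w t × Anc v h × ¬ Anc w h
  orient he hf (inj₁ (t∈ , h∈ , h∉)) =
    _ , _ , inj₁ (refl , refl) , inSub→anc hf t∈ , inSub→anc he h∈ , h∉ ∘ (_ ,_) ∘ (hf ,_)
  orient he hf (inj₂ (t∈ , h∈ , h∉)) =
    _ , _ , inj₂ (refl , refl) , inSub→anc hf t∈ , inSub→anc he h∈ , h∉ ∘ (_ ,_) ∘ (hf ,_)

  deepest-on-path : ∀ {P : Fin n → Set} → Decidable P → ∀ {v u} → Anc v u → P v →
                    Σ (Fin n) λ w → Anc v w × Anc w u × P w × (∀ w′ → Anc w′ u → P w′ → Anc w′ w)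
  deepest-on-path P? {u = u} here pv = u , here , here , pv , λ _ w′≤u _ → w′≤u
  deepest-on-path {P} P? (up {u} u≢r v≤pu) pv with P? u
  ... | yes pu = u , up u≢r v≤pu , here , pu , λ _ w′≤u _ → w′≤u
  ... | no ¬pu with deepest-on-path P? v≤pu pv
  ...   | w , v≤w , w≤pu , pw , deepest =
    w , v≤w , up u≢r w≤pu , pw ,
    λ w′ w′≤u pw′ → deepest w′ (proj₂ (anc-inv w′≤u λ { refl → ¬pu pw′ })) pw′

  tree-edge-leaving-subtree : ∀ {x a c v} → IsTreeEdge x → Ends G x a c →
                              Anc v a → ¬ Anc v c → x ≡ pe v
  tree-edge-leaving-subtree {v = v} (w , w≢r , refl) en v≤a v⋪c
    with ends-match G en (pe-ends w w≢r)
  ... | inj₂ (refl , refl) = ⊥-elim (v⋪c (up w≢r v≤a))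
  ... | inj₁ (refl , refl) with w ≟ v
  ...   | yes refl = refl
  ...   | no w≢v = ⊥-elim (v⋪c (proj₂ (anc-inv v≤a (w≢v ∘ sym))))

module DFSTreeProperties {n m : ℕ} {G : Graph n m} (DT : DFSTree G) where
  open DFSTree DT
  open SpanningTree tree
  open Tree G tree
  open SpanningTreeProperties tree public

  Leaps : Fin n → Fin m → Fin n → Fin n → Set
  Leaps v b p q = BackEdge b p q × Anc v p × ¬ Anc v q

  back-edge-ends : ∀ {x a c} → ¬ IsTreeEdge x → Ends G x a c → Anc a c ⊎ Anc c a
  back-edge-ends {x} nt en with back-anc x nt | en
  ... | inj₁ a | inj₁ (refl , refl) = inj₁ a
  ... | inj₁ a | inj₂ (refl , refl) = inj₂ a
  ... | inj₂ a | inj₁ (refl , refl) = inj₂ a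
  ... | inj₂ a | inj₂ (refl , refl) = inj₁ a

  exit-subtree : ∀ {R v} (ex : Exit G R (Anc v)) → R (pe v) →
                 let open Exit ex in Leaps v edge inner outer
  exit-subtree (exit x a c kept en v≤a v⋪c) removed with tree? x
  ... | yes tx = ⊥-elim (kept (subst _ (sym (tree-edge-leaving-subtree tx en v≤a v⋪c)) removed))
  ... | no nt with back-edge-ends nt en
  ...   | inj₁ a≤c = ⊥-elim (v⋪c (anc-trans v≤a a≤c))
  ...   | inj₂ c≤a = (nt , en , c≤a) , v≤a , v⋪c

  exit-between : ∀ {R u v} (ex : Exit G R (Between u v)) → R (pe u) → R (pe v) →
                 let open Exit ex in Leaps u edge inner outer ⊎ Leaps v edge outer inner
  exit-between {v = v} (exit x a c kept en (u≤a , v⋪a) c∉) ru rv with anc? v c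
  ... | yes v≤c = inj₂ (exit-subtree (exit x c a kept (ends-sym G en) v≤c v⋪a) rv)
  ... | no v⋪c = inj₁ (exit-subtree (exit x a c kept en u≤a λ u≤c → c∉ (u≤c , v⋪c)) ru)

  tailsIn→anc : ∀ {v d w b p q} → v ≢ root → HeadOf d w → TailsIn (pe v) d →
                Leaps v b p q → Anc w p
  tailsIn→anc v≢r hd tails (back , v≤p , v⋪q) =
    inSub→anc hd (tails _ _ _ back (_ , (v≢r , refl) , v≤p) (v⋪q ∘ inSub→anc (v≢r , refl)))

module ThreeCut {n m : ℕ} {G : Graph n m} (DT : DFSTree G) where
  open DFSTree DT
  open SpanningTree tree
  open Tree G tree
  open DFSTreeProperties DT

  module WithCut (con2 : ∀ e₁ e₂ → ConnectedWithout G (λ x → x ≡ e₁ ⊎ x ≡ e₂))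
    {ve vf : Fin n} (ve≢r : ve ≢ root) (vf≢r : vf ≢ root) (e<f : pe ve <T pe vf)
    {g : Fin m} (g-back : IsBackEdge g)
    {tg hg : Fin n} (g-ends : Ends G g tg hg)
    (vf≤tg : Anc vf tg) (ve≤hg : Anc ve hg) (vf⋪hg : ¬ Anc vf hg)
    (cut : ¬ ConnectedWithout G (λ x → x ≡ pe ve ⊎ x ≡ pe vf ⊎ x ≡ g)) where

    e f : Fin m
    e = pe ve
    f = pe vf

    Cut : Fin m → Set
    Cut x = x ≡ e ⊎ x ≡ f ⊎ x ≡ g

    ve≤vf : Anc ve vf
    ve≤vf = ≤T→anc (ve≢r , refl) (vf≢r , refl) (proj₁ e<f)

    vf⋪ve : ¬ Anc vf ve
    vf⋪ve = proj₂ e<f ∘ cong pe ∘ anc-antisym ve≤vf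

    cut-tree-edge : ∀ {y} → y ≢ root → Cut (pe y) → y ≡ ve ⊎ y ≡ vf
    cut-tree-edge y≢r (inj₁ eq) = inj₁ (head-unique (y≢r , eq) (ve≢r , refl))
    cut-tree-edge y≢r (inj₂ (inj₁ eq)) = inj₂ (head-unique (y≢r , eq) (vf≢r , refl))
    cut-tree-edge y≢r (inj₂ (inj₂ eq)) = ⊥-elim (g-back (_ , y≢r , eq))

    back-edge-kept : ∀ {x} → ¬ IsTreeEdge x → x ≢ g → ¬ Cut x
    back-edge-kept nt _ (inj₁ refl) = nt (ve , ve≢r , refl)
    back-edge-kept nt _ (inj₂ (inj₁ refl)) = nt (vf , vf≢r , refl)
    back-edge-kept _ x≢g (inj₂ (inj₂ x≡g)) = x≢g x≡g

    g-end-in-T_e : ∀ {a c} → Ends G g a c → Anc ve c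
    g-end-in-T_e en with ends-match G en g-ends
    ... | inj₁ (_ , refl) = ve≤hg
    ... | inj₂ (_ , refl) = anc-trans ve≤vf vf≤tg

    climb-T_f : ∀ {u} → Anc vf u → Reach G Cut u vf
    climb-T_f vf≤u = climb vf≤u keep
      where
      keep : ∀ {y} → y ≢ vf → Anc vf y → Anc y _ → ¬ Cut (pe y)
      keep {y} y≢vf vf≤y _ c with cut-tree-edge (λ { refl → ¬anc-root vf≢r vf≤y }) c
      ... | inj₁ refl = vf⋪ve vf≤y
      ... | inj₂ y≡vf = y≢vf y≡vf

    climb-T_e∖T_f : ∀ {u} → Anc ve u → ¬ Anc vf u → Reach G Cut u ve
    climb-T_e∖T_f ve≤u vf⋪u = climb ve≤u keep
      where
      keep : ∀ {y} → y ≢ ve → Anc ve y → Anc y _ → ¬ Cut (pe y)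
      keep {y} y≢ve ve≤y y≤u c with cut-tree-edge (λ { refl → ¬anc-root ve≢r ve≤y }) c
      ... | inj₁ y≡ve = y≢ve y≡ve
      ... | inj₂ refl = vf⋪u y≤u

    climb-outside-T_e : ∀ {u} → ¬ Anc ve u → Reach G Cut u root
    climb-outside-T_e ve⋪u = climb (root-anc _) keep
      where
      keep : ∀ {y} → y ≢ root → Anc root y → Anc y _ → ¬ Cut (pe y)
      keep y≢r _ y≤u c with cut-tree-edge y≢r c
      ... | inj₁ refl = ve⋪u y≤u
      ... | inj₂ refl = ve⋪u (anc-trans ve≤vf y≤u)

    -- If ve reached the root, then so would vf, because the 2-edge-cut {f,g}
    -- leaves an edge out of T_f, which cannot be the tree edge f.
    T_e∖T_f-cut-off : ¬ Reach G Cut ve root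
    T_e∖T_f-cut-off ve→r = cut λ u v → reach-trans (to-root u) (reach-sym (to-root v))
      where
      outside-T_f : ∀ {u} → ¬ Anc vf u → Reach G Cut u root
      outside-T_f {u} vf⋪u with anc? ve u
      ... | yes ve≤u = reach-trans (climb-T_e∖T_f ve≤u vf⋪u) ve→r
      ... | no ve⋪u = climb-outside-T_e ve⋪u

      vf→r : Reach G Cut vf root
      vf→r with reach-exit G (Anc vf) (anc? vf) here (¬anc-root vf≢r) (con2 f g vf root)
      ... | ex@(exit x _ _ kept en vf≤a vf⋪c) with exit-subtree ex (inj₁ refl)
      ...   | (nt , _) , _ =
        reach-trans (reach-sym (climb-T_f vf≤a))
                    (step x (back-edge-kept nt (kept ∘ inj₂)) en (outside-T_f vf⋪c))

      to-root : ∀ u → Reach G Cut u root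
      to-root u with anc? vf u
      ... | yes vf≤u = reach-trans (climb-T_f vf≤u) vf→r
      ... | no vf⋪u = outside-T_f vf⋪u

    leap-over-e-from-T_f : ∀ {b p q} → Leaps ve b p q → Anc vf p
    leap-over-e-from-T_f {b} {p} ((nt , en , _) , ve≤p , ve⋪q) with anc? vf p
    ... | yes vf≤p = vf≤p
    ... | no vf⋪p = ⊥-elim (T_e∖T_f-cut-off
            (reach-trans (reach-sym (climb-T_e∖T_f ve≤p vf⋪p))
                         (step b (back-edge-kept nt b≢g) en (climb-outside-T_e ve⋪q))))
      where
      b≢g : b ≢ g
      b≢g refl = ve⋪q (g-end-in-T_e en)

    tailsIn-e-f : TailsIn e f
    tailsIn-e-f b p q back p∈T_e q∉T_e =
      vf , (vf≢r , refl) ,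
      leap-over-e-from-T_f (back , inSub→anc (ve≢r , refl) p∈T_e , q∉T_e ∘ (ve ,_) ∘ ((ve≢r , refl) ,_))

    leap-over-e : Σ (Fin m) λ b → Σ (Fin n) λ p → Σ (Fin n) λ q → Leaps ve b p q × b ≢ g
    leap-over-e with reach-exit G (Anc ve) (anc? ve) here (¬anc-root ve≢r) (con2 e g ve root)
    ... | ex@(exit b p q kept _ _ _) = b , p , q , exit-subtree ex (inj₁ refl) , kept ∘ inj₂

    vf-reaches-root : Reach G Cut vf root
    vf-reaches-root with leap-over-e
    ... | b , _ , _ , leap@((nt , en , _) , _ , ve⋪q) , b≢g =
      reach-trans (reach-sym (climb-T_f (leap-over-e-from-T_f leap)))
                  (step b (back-edge-kept nt b≢g) en (climb-outside-T_e ve⋪q))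

    g-only-edge-T_f-to-T_e∖T_f : ∀ {x a b} → ¬ IsTreeEdge x → Ends G x a b →
                                 Anc vf a → Anc ve b → ¬ Anc vf b → b ≢ hg → ⊥
    g-only-edge-T_f-to-T_e∖T_f {x} nt en vf≤a ve≤b vf⋪b b≢hg =
      T_e∖T_f-cut-off
        (reach-trans (reach-sym (climb-T_e∖T_f ve≤b vf⋪b))
          (step x (back-edge-kept nt x≢g) (ends-sym G en)
            (reach-trans (climb-T_f vf≤a) vf-reaches-root)))
      where
      x≢g : x ≢ g
      x≢g refl with ends-match G en g-ends
      ... | inj₁ (_ , b≡hg) = b≢hg b≡hg
      ... | inj₂ (refl , _) = vf⋪hg vf≤a

    Candidate : Fin n → Set
    Candidate w = w ≢ root × Anc ve w × TailsIn e (pe w)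

    candidate? : Decidable Candidate
    candidate? w = ¬? (w ≟ root) ×-dec anc? ve w ×-dec tailsIn? e (pe w)

    deepestDnCut-e-≥-f : DnCutGe e f
    deepestDnCut-e-≥-f with leap-over-e
    ... | _ , _ , _ , leap , _
      with deepest-on-path candidate? (leap-over-e-from-T_f leap) (vf≢r , ve≤vf , tailsIn-e-f)
    ...   | w , vf≤w , _ , (w≢r , ve≤w , tails) , deepest =
      pe w , ((w , w≢r , refl) , (ve , w , (ve≢r , refl) , (w≢r , refl) , ve≤w) , tails , maximal) ,
      (vf , w , (vf≢r , refl) , (w≢r , refl) , vf≤w)
      where
      maximal : ∀ d → IsTreeEdge d → e ≤T d → TailsIn e d → d ≤T pe w
      maximal _ (w′ , hd@(w′≢r , refl)) e≤d tails′ =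
        w′ , w , hd , (w≢r , refl) ,
        deepest w′ (tailsIn→anc ve≢r hd tails′ leap) (w′≢r , ≤T→anc (ve≢r , refl) hd e≤d , tails′)

    module StrictlyBetween {we : Fin n} (we≢r : we ≢ root) (ve≤we : Anc ve we) (ve≢we : ve ≢ we)
      (we≤vf : Anc we vf) (we≢vf : we ≢ vf)
      (leap-over-e′-from-T_f : ∀ {b p q} → Leaps we b p q → Anc vf p) where

      we⋪ve : ¬ Anc we ve
      we⋪ve = ve≢we ∘ anc-antisym ve≤we

      vf⋪we : ¬ Anc vf we
      vf⋪we = we≢vf ∘ anc-antisym we≤vf

      hg∈T_e′-impossible : ¬ Anc we hg
      hg∈T_e′-impossible we≤hg
        with reach-exit G (Between ve we) (between? ve we) (here , we⋪ve)
               (¬anc-root ve≢r ∘ proj₁) (con2 e (pe we) ve root)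
      ... | ex@(exit _ _ _ _ _ (ve≤a , we⋪a) _) with exit-between ex (inj₁ refl) (inj₂ refl)
      ...   | inj₁ leap = we⋪a (anc-trans we≤vf (leap-over-e-from-T_f leap))
      ...   | inj₂ leap@((nt , en , _) , _) =
        g-only-edge-T_f-to-T_e∖T_f nt en (leap-over-e′-from-T_f leap) ve≤a
          (we⋪a ∘ anc-trans we≤vf) λ { refl → we⋪a we≤hg }

      hg∉T_e′-impossible : ¬ ¬ Anc we hg
      hg∉T_e′-impossible we⋪hg
        with reach-exit G (Between we vf) (between? we vf) (here , vf⋪we)
               (¬anc-root we≢r ∘ proj₁) (con2 (pe we) f we root)
      ... | ex@(exit _ _ _ _ _ (we≤a , vf⋪a) _) with exit-between ex (inj₁ refl) (inj₂ refl)
      ...   | inj₁ leap = vf⋪a (leap-over-e′-from-T_f leap)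
      ...   | inj₂ ((nt , en , _) , vf≤c , _) =
        g-only-edge-T_f-to-T_e∖T_f nt en vf≤c (anc-trans ve≤we we≤a) vf⋪a
          λ { refl → we⋪hg we≤a }

    deepestDnCut-≥-f-only-below-e : ∀ e′ → IsTreeEdge e′ → e′ <T f → DnCutGe e′ f → e′ ≤T e
    deepestDnCut-≥-f-only-below-e _ (we , he′@(we≢r , refl)) (e′≤f , e′≢f)
                                  (_ , ((_ , hd) , _ , tails , _) , f≤d)
      with anc-chain (≤T→anc he′ (vf≢r , refl) e′≤f) ve≤vf
    ... | inj₁ we≤ve = we , ve , he′ , (ve≢r , refl) , we≤ve
    ... | inj₂ ve≤we with ve ≟ we
    ...   | yes refl = ve , ve , he′ , he′ , here
    ...   | no ve≢we = ⊥-elim (hg∉T_e′-impossible hg∈T_e′-impossible)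
      where
      we≤vf = ≤T→anc he′ (vf≢r , refl) e′≤f
      open StrictlyBetween we≢r ve≤we ve≢we we≤vf (e′≢f ∘ cong pe)
        (λ leap → anc-trans (≤T→anc (vf≢r , refl) hd f≤d) (tailsIn→anc we≢r hd tails leap))

lemma5p4 : ∀ {n m : ℕ} (G : Graph n m) (T : DFSTree G) → ThreeEdgeConnected G →
    let open Tree G (DFSTree.tree T) in
    ∀ (e f g : Fin m) → IsTreeEdge e → IsTreeEdge f → e <T f →
    IsBackEdge g →
    ((InSub f (src G g) × InSub e (dst G g) × ¬ InSub f (dst G g)) ⊎
     (InSub f (dst G g) × InSub e (src G g) × ¬ InSub f (src G g))) →
    IsThreeEdgeCut G e f g →
    (e <T f × DnCutGe e f ×
     (∀ e' → IsTreeEdge e' → e' <T f → DnCutGe e' f → e' ≤T e))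
lemma5p4 G T (_ , con2) _ _ g (ve , he@(ve≢r , refl)) (vf , hf@(vf≢r , refl)) e<f g-back g-joins
         (_ , _ , _ , cut)
  with DFSTreeProperties.orient T he hf g-joins
... | _ , _ , g-ends , vf≤tg , ve≤hg , vf⋪hg =
  e<f , deepestDnCut-e-≥-f , deepestDnCut-≥-f-only-below-e
  where
  open ThreeCut.WithCut T con2 ve≢r vf≢r e<f g-back g-ends vf≤tg ve≤hg vf⋪hg cut
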